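{- Let $G$ be a finite graph and let $A,B\subseteq V(G)$ satisfy $|A|\geq \tfrac{1}{2}|G|$ and $|B|> \tfrac{1}{2}|G|$. Then there is a path $P$ in $G$ between a vertex in $A$ and a vertex in $B$ such that $$\Delta(G\setminus P) \leq \tfrac{1}{2}|G\setminus P|.$$
   Context: A single vertex is a path (with both endpoints equal to it). $G\setminus P$ denotes the induced subgraph of $G$ on $V(G)\setminus V(P)$, $|G\setminus P|$ its number of vertices and $\Delta$ the maximum degree; the maximum degree of the graph with no vertices is taken to be $-\tfrac12$. -}

module Defs where

open import Data.Nat using (ℕ; _+_; _*_; _≤_)
open import Data.Bool using (Bool; true; false; not; _∧_; if_then_else_; T)
open import Data.Fin using (Fin; _≟_)
open import Data.List using (List; []; _∷_; map; allFin)
open import Data.Nat.ListAction using (sum)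
open import Data.Bool.ListAction using (any)
open import Data.List.Relation.Unary.Linked using (Linked)
open import Data.List.Relation.Unary.Unique.Propositional using (Unique)
open import Data.Product using (_×_)
open import Relation.Binary.PropositionalEquality using (_≡_)
open import Relation.Nullary.Decidable using (⌊_⌋)

record Graph (n : ℕ) : Set where
  field
    Adj    : Fin n → Fin n → Bool
    sym    : ∀ u v → Adj u v ≡ Adj v u
    irrefl : ∀ v → Adj v v ≡ false
open Graph public

count : {n : ℕ} → (Fin n → Bool) → ℕ
count {n} f = sum (map (λ w → if f w then 1 else 0) (allFin n))

onPath : {n : ℕ} → List (Fin n) → Fin n → Bool
onPath P w = any (λ u → ⌊ u ≟ w ⌋) P

IsPath : {n : ℕ} → Graph n → List (Fin n) → Set
IsPath G []      = Data.Bool.T false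
IsPath G (v ∷ vs) = Unique (v ∷ vs) × Linked (λ a b → T (Adj G a b)) (v ∷ vs)

sizeMinus : {n : ℕ} → List (Fin n) → ℕ
sizeMinus P = count (λ w → not (onPath P w))

degMinus : {n : ℕ} → Graph n → List (Fin n) → Fin n → ℕ
degMinus G P v = count (λ w → Adj G v w ∧ not (onPath P w))

-- Δ(G \ P) ≤ ½ |G \ P|  (vacuous when G \ P is empty, matching Δ(∅) = -1/2)
MaxDegHalf : {n : ℕ} → Graph n → List (Fin n) → Set
MaxDegHalf G P = ∀ v → onPath P v ≡ false → 2 * degMinus G P v ≤ sizeMinus P

-- Induct on a vertex set U containing A and B, with |U| ≤ 2|A| and |U| < 2|B|, and
-- look for a path inside U.  If every vertex has fewer than |U|/2 neighbours in U, then
-- |A| + |B| > |U| gives a common vertex x, and the one-vertex path x works: deleting it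
-- lowers |U| by one while degrees stay below |U|/2.  Otherwise some v has at least |U|/2
-- neighbours in U.  If v ∈ A, start the path at v and recurse in U - v with A replaced by
-- the neighbourhood N(v); if v ∈ B, end it at v symmetrically.  If v lies in neither, the
-- counts force some x ∈ A ∩ N(v); the path begins x, v and continues, by recursion in
-- U - v - x, from a vertex of N(v).  Each recursive call shrinks U by one or two vertices
-- and each endpoint set by at most as many, so the size conditions are inherited.

module Submission where

open import Defs renaming (sym to Adj-sym)
open import Data.Nat using (ℕ; zero; suc; _+_; _*_; _≤_; _<_; s≤s; _≤?_; _<?_)
open import Data.Nat.Properties
  using (≤-reflexive; ≤-trans; <-trans; ≤-<-trans; <-≤-trans; <⇒≤; ≤-antisym; ≤-pred;
         m≤n⇒m≤1+n; ≰⇒>; ≮⇒≥; >⇒≢; +-identityʳ; +-suc; *-suc; *-distribˡ-+;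
         +-monoˡ-≤; +-mono-≤; +-mono-≤-<; +-cancelˡ-≤; +-cancelˡ-<; *-monoʳ-≤; *-cancelˡ-≤; *-cancelˡ-<;
         module ≤-Reasoning)
open import Data.Bool using (Bool; true; false; not; _∧_; _∨_; if_then_else_; T)
open import Data.Bool.Properties using (¬-not; T-≡)
open import Data.Fin using (Fin; zero; suc; _≟_)
open import Data.Fin.Properties using (any?)
open import Data.Fin.Subset
  using (Subset; outside; inside; ⊤; ⁅_⁆; _∈_; _∉_; _⊆_; _⊂_; _∪_; _∩_; _─_; _-_; ⋃; ∣_∣; Nonempty)
open import Data.Fin.Subset.Properties
  using (_∈?_; nonempty?; Empty-unique; ∣⊥∣≡0; ∣⊤∣≡n; ⊆⊤; ⊆-refl; ⊆-⊂-trans; p⊆q⇒∣p∣≤∣q∣;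
         x∈⁅x⁆; x∈⁅y⁆⇒x≡y; x∉⁅y⁆⇒x≢y; x∈p∩q⁺; x∈p∩q⁻; x∈p∪q⁻; p∩q⊆p;
         ∪-assoc; ∪-comm; ∪-identityˡ; ∪-identityʳ;
         p─⊥≡p; p─q─r≡p─q∪r; p─x─y≡p─y─x; p─q⊆p; x∈p∧x≢y⇒x∈p-y; x∈p⇒p-x⊂p; x∈p⇒∣p-x∣<∣p∣)
open import Data.Fin.Subset.Induction using (Acc; acc; ⊂-wellFounded)
open import Data.List using (List; []; _∷_; _∷ʳ_; head; last; map)
import Data.List as List
import Data.List.Properties as List
open import Data.List.Relation.Unary.All as All using (All; []; _∷_)
import Data.List.Relation.Unary.All.Properties as All
open import Data.List.Relation.Unary.AllPairs using ([]; _∷_)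
import Data.List.Relation.Unary.AllPairs.Properties as AllPairs
open import Data.List.Relation.Unary.Linked using ([-]; _∷_)
import Data.List.Relation.Unary.Linked.Properties as Linked
open import Data.Maybe using (just)
open import Data.Maybe.Relation.Binary.Connected using (Connected; just)
open import Data.Nat.ListAction using (sum)
open import Data.Product using (Σ; _×_; _,_; proj₁; proj₂)
open import Data.Sum using ([_,_])
open import Data.Vec using ([]; _∷_; here; there; lookup; tabulate)
open import Data.Vec.Properties
  using ([]=⇒lookup; lookup⇒[]=; lookup-replicate; lookup-zipWith; lookup∘tabulate; tabulate∘lookup; tabulate-cong)
open import Function using (_∘_; Equivalence)
open import Relation.Binary.PropositionalEquality
  using (_≡_; _≢_; refl; sym; trans; cong; cong₂; subst; subst₂; ≢-sym; module ≡-Reasoning)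
open import Relation.Nullary using (¬_; yes; no; contradiction; _×-dec_)
open import Relation.Nullary.Decidable using (⌊_⌋)

private variable
  n : ℕ
  p q r : Subset n
  x y : Fin n

m≤2a∧m<2b⇒m<a+b : ∀ {m} a b → m ≤ 2 * a → m < 2 * b → m < a + b
m≤2a∧m<2b⇒m<a+b {m} a b m≤2a m<2b = *-cancelˡ-< 2 m (a + b) (begin-strict
  2 * m         ≡⟨ cong (m +_) (+-identityʳ m) ⟩
  m + m         <⟨ +-mono-≤-< m≤2a m<2b ⟩
  2 * a + 2 * b ≡⟨ *-distribˡ-+ 2 a b ⟨
  2 * (a + b)   ∎)
  where open ≤-Reasoning

m≤2a∧m≤2b⇒m≤a+b : ∀ {m} a b → m ≤ 2 * a → m ≤ 2 * b → m ≤ a + b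
m≤2a∧m≤2b⇒m≤a+b {m} a b m≤2a m≤2b = *-cancelˡ-≤ 2 (begin
  2 * m         ≡⟨ cong (m +_) (+-identityʳ m) ⟩
  m + m         ≤⟨ +-mono-≤ m≤2a m≤2b ⟩
  2 * a + 2 * b ≡⟨ *-distribˡ-+ 2 a b ⟨
  2 * (a + b)   ∎)
  where open ≤-Reasoning

2+m≤2[1+a]⇒m≤2a : ∀ {m} a → 2 + m ≤ 2 * suc a → m ≤ 2 * a
2+m≤2[1+a]⇒m≤2a {m} a 2+m≤2[1+a] = +-cancelˡ-≤ 2 m (2 * a) (subst (2 + m ≤_) (*-suc 2 a) 2+m≤2[1+a])

2+m<2b∧b≤1+c⇒m<2c : ∀ {m b} c → 2 + m < 2 * b → b ≤ suc c → m < 2 * c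
2+m<2b∧b≤1+c⇒m<2c {m} {b} c 2+m<2b b≤1+c =
  +-cancelˡ-< 2 m (2 * c) (<-≤-trans 2+m<2b (subst (2 * b ≤_) (*-suc 2 c) (*-monoʳ-≤ 2 b≤1+c)))

m≮2b∧1+m<2[1+b]∧1+m≤2[1+a]⇒m≤2a : ∀ {m} a b → ¬ m < 2 * b → suc m < 2 * suc b → suc m ≤ 2 * suc a → m ≤ 2 * a
m≮2b∧1+m<2[1+b]∧1+m≤2[1+a]⇒m≤2a a b m≮2b 1+m<2[1+b] 1+m≤2[1+a] =
  ≤-trans (2+m≤2[1+a]⇒m≤2a b 1+m<2[1+b]) (*-monoʳ-≤ 2 b≤a)
  where
    b≤a : b ≤ a
    b≤a = ≤-pred (*-cancelˡ-< 2 b (suc a) (≤-<-trans (≮⇒≥ m≮2b) 1+m≤2[1+a]))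

∣p∣≤1+∣p-x∣ : ∀ (p : Subset n) x → ∣ p ∣ ≤ suc ∣ p - x ∣
∣p∣≤1+∣p-x∣ (outside ∷ p) zero    = m≤n⇒m≤1+n (≤-reflexive (cong ∣_∣ (sym (p─⊥≡p p))))
∣p∣≤1+∣p-x∣ (inside  ∷ p) zero    = s≤s (≤-reflexive (cong ∣_∣ (sym (p─⊥≡p p))))
∣p∣≤1+∣p-x∣ (outside ∷ p) (suc x) = ∣p∣≤1+∣p-x∣ p x
∣p∣≤1+∣p-x∣ (inside  ∷ p) (suc x) = s≤s (∣p∣≤1+∣p-x∣ p x)

x∈p⇒∣p∣≡1+∣p-x∣ : x ∈ p → ∣ p ∣ ≡ suc ∣ p - x ∣
x∈p⇒∣p∣≡1+∣p-x∣ {x = x} {p = p} x∈p = ≤-antisym (∣p∣≤1+∣p-x∣ p x) (x∈p⇒∣p-x∣<∣p∣ x∈p)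

∣p∪q∣+∣p∩q∣≡∣p∣+∣q∣ : ∀ (p q : Subset n) → ∣ p ∪ q ∣ + ∣ p ∩ q ∣ ≡ ∣ p ∣ + ∣ q ∣
∣p∪q∣+∣p∩q∣≡∣p∣+∣q∣ []            []            = refl
∣p∪q∣+∣p∩q∣≡∣p∣+∣q∣ (outside ∷ p) (outside ∷ q) = ∣p∪q∣+∣p∩q∣≡∣p∣+∣q∣ p q
∣p∪q∣+∣p∩q∣≡∣p∣+∣q∣ (outside ∷ p) (inside  ∷ q) =
  trans (cong suc (∣p∪q∣+∣p∩q∣≡∣p∣+∣q∣ p q)) (sym (+-suc ∣ p ∣ ∣ q ∣))
∣p∪q∣+∣p∩q∣≡∣p∣+∣q∣ (inside  ∷ p) (outside ∷ q) = cong suc (∣p∪q∣+∣p∩q∣≡∣p∣+∣q∣ p q)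
∣p∪q∣+∣p∩q∣≡∣p∣+∣q∣ (inside  ∷ p) (inside  ∷ q) = cong suc (begin
  ∣ p ∪ q ∣ + suc ∣ p ∩ q ∣   ≡⟨ +-suc ∣ p ∪ q ∣ ∣ p ∩ q ∣ ⟩
  suc (∣ p ∪ q ∣ + ∣ p ∩ q ∣) ≡⟨ cong suc (∣p∪q∣+∣p∩q∣≡∣p∣+∣q∣ p q) ⟩
  suc (∣ p ∣ + ∣ q ∣)         ≡⟨ +-suc ∣ p ∣ ∣ q ∣ ⟨
  ∣ p ∣ + suc ∣ q ∣           ∎)
  where open ≡-Reasoning

∪-least : p ⊆ r → q ⊆ r → p ∪ q ⊆ r
∪-least {p = p} {q = q} p⊆r q⊆r x∈p∪q = [ p⊆r , q⊆r ] (x∈p∪q⁻ p q x∈p∪q)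

∩-monoʳ-⊆ : q ⊆ r → p ∩ q ⊆ p ∩ r
∩-monoʳ-⊆ {q = q} {p = p} q⊆r x∈p∩q with x∈p∩q⁻ p q x∈p∩q
... | x∈p , x∈q = x∈p∩q⁺ (x∈p , q⊆r x∈q)

x∈p─q⇒x∉q : ∀ (p q : Subset n) → x ∈ p ─ q → x ∉ q
x∈p─q⇒x∉q (_ ∷ p) (outside ∷ q) here          ()
x∈p─q⇒x∉q (_ ∷ p) (_       ∷ q) (there x∈p─q) (there x∈q) = x∈p─q⇒x∉q p q x∈p─q x∈q

x∈p-y⇒x≢y : x ∈ p - y → x ≢ y
x∈p-y⇒x≢y {p = p} {y = y} x∈p-y = x∉⁅y⁆⇒x≢y (x∈p─q⇒x∉q p ⁅ y ⁆ x∈p-y)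

p⊆q⇒p-x⊆q-x : p ⊆ q → p - x ⊆ q - x
p⊆q⇒p-x⊆q-x {p = p} {x = x} p⊆q y∈p-x =
  x∈p∧x≢y⇒x∈p-y (p⊆q (p─q⊆p p ⁅ x ⁆ y∈p-x)) (x∈p-y⇒x≢y y∈p-x)

x∉p∧p⊆q⇒p⊆q-x : x ∉ p → p ⊆ q → p ⊆ q - x
x∉p∧p⊆q⇒p⊆q-x x∉p p⊆q y∈p = x∈p∧x≢y⇒x∈p-y (p⊆q y∈p) (λ { refl → x∉p y∈p })

∣p∣>0⇒Nonempty : ∀ {n} {p : Subset n} → 0 < ∣ p ∣ → Nonempty p
∣p∣>0⇒Nonempty {n} {p} 0<∣p∣ with nonempty? p
... | yes ne = ne
... | no ¬ne = contradiction (trans (cong ∣_∣ (Empty-unique ¬ne)) (∣⊥∣≡0 n)) (>⇒≢ 0<∣p∣)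

∣r∣<∣p∣+∣q∣⇒p∩q≢∅ : p ⊆ r → q ⊆ r → ∣ r ∣ < ∣ p ∣ + ∣ q ∣ → Nonempty (p ∩ q)
∣r∣<∣p∣+∣q∣⇒p∩q≢∅ {p = p} {r = r} {q = q} p⊆r q⊆r ∣r∣<∣p∣+∣q∣ =
  ∣p∣>0⇒Nonempty (+-cancelˡ-< (∣ r ∣) 0 (∣ p ∩ q ∣) (begin-strict
    ∣ r ∣ + 0             ≡⟨ +-identityʳ ∣ r ∣ ⟩
    ∣ r ∣                 <⟨ ∣r∣<∣p∣+∣q∣ ⟩
    ∣ p ∣ + ∣ q ∣         ≡⟨ ∣p∪q∣+∣p∩q∣≡∣p∣+∣q∣ p q ⟨
    ∣ p ∪ q ∣ + ∣ p ∩ q ∣ ≤⟨ +-monoˡ-≤ ∣ p ∩ q ∣ (p⊆q⇒∣p∣≤∣q∣ (∪-least p⊆r q⊆r)) ⟩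
    ∣ r ∣ + ∣ p ∩ q ∣     ∎))
  where open ≤-Reasoning

last-∷ʳ : ∀ {a} {A : Set a} (xs : List A) x → last (xs ∷ʳ x) ≡ just x
last-∷ʳ []           x = refl
last-∷ʳ (_ ∷ [])     x = refl
last-∷ʳ (_ ∷ y ∷ xs) x = last-∷ʳ (y ∷ xs) x

vertices : List (Fin n) → Subset n
vertices xs = ⋃ (map ⁅_⁆ xs)

vertices-∷ʳ : ∀ (xs : List (Fin n)) x → vertices (xs ∷ʳ x) ≡ vertices xs ∪ ⁅ x ⁆
vertices-∷ʳ []       x = trans (∪-identityʳ ⁅ x ⁆) (sym (∪-identityˡ ⁅ x ⁆))
vertices-∷ʳ (y ∷ xs) x = trans (cong (⁅ y ⁆ ∪_) (vertices-∷ʳ xs x)) (sym (∪-assoc ⁅ y ⁆ (vertices xs) ⁅ x ⁆))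

lookup-⁅⁆ : ∀ (x y : Fin n) → lookup ⁅ x ⁆ y ≡ ⌊ x ≟ y ⌋
lookup-⁅⁆ x y with x ≟ y
... | yes refl = []=⇒lookup (x∈⁅x⁆ x)
... | no x≢y   = ¬-not (λ y∈⁅x⁆ → x≢y (sym (x∈⁅y⁆⇒x≡y x (lookup⇒[]= y ⁅ x ⁆ y∈⁅x⁆))))

lookup-vertices : ∀ (xs : List (Fin n)) y → lookup (vertices xs) y ≡ onPath xs y
lookup-vertices []       y = lookup-replicate y outside
lookup-vertices (x ∷ xs) y =
  trans (lookup-zipWith _ y ⁅ x ⁆ (vertices xs)) (cong₂ _∨_ (lookup-⁅⁆ x y) (lookup-vertices xs y))

lookup-⊤─ : ∀ (p : Subset n) x → lookup (⊤ ─ p) x ≡ not (lookup p x)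
lookup-⊤─ (outside ∷ p) zero    = refl
lookup-⊤─ (inside  ∷ p) zero    = refl
lookup-⊤─ (_       ∷ p) (suc x) = lookup-⊤─ p x

∣tabulate∣≡sum : (f : Fin n → Bool) → ∣ tabulate f ∣ ≡ sum (List.tabulate (λ x → if f x then 1 else 0))
∣tabulate∣≡sum {zero}  f = refl
∣tabulate∣≡sum {suc n} f with f zero
... | true  = cong suc (∣tabulate∣≡sum (f ∘ suc))
... | false = ∣tabulate∣≡sum (f ∘ suc)

count≡∣tabulate∣ : (f : Fin n → Bool) → count f ≡ ∣ tabulate f ∣
count≡∣tabulate∣ {n} f =
  trans (cong sum (List.map-tabulate {n = n} (λ x → x) (λ x → if f x then 1 else 0))) (sym (∣tabulate∣≡sum f))

tabulate-∧ : (f g : Fin n → Bool) → tabulate (λ x → f x ∧ g x) ≡ tabulate f ∩ tabulate g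
tabulate-∧ {zero}  f g = refl
tabulate-∧ {suc n} f g = cong (f zero ∧ g zero ∷_) (tabulate-∧ (f ∘ suc) (g ∘ suc))

tabulate-¬onPath : ∀ (xs : List (Fin n)) → tabulate (λ y → not (onPath xs y)) ≡ ⊤ ─ vertices xs
tabulate-¬onPath xs = trans
  (tabulate-cong (λ y → trans (cong not (sym (lookup-vertices xs y))) (sym (lookup-⊤─ (vertices xs) y))))
  (tabulate∘lookup (⊤ ─ vertices xs))

module _ {n : ℕ} (G : Graph n) where

  neighbours : Fin n → Subset n
  neighbours v = tabulate (Adj G v)

  ∈-neighbours⁻ : ∀ {v w} → w ∈ neighbours v → Adj G v w ≡ true
  ∈-neighbours⁻ {v} {w} w∈N = trans (sym (lookup∘tabulate (Adj G v) w)) ([]=⇒lookup w∈N)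

  adjacent : ∀ {v w} → w ∈ neighbours v → T (Adj G v w)
  adjacent w∈N = Equivalence.from T-≡ (∈-neighbours⁻ w∈N)

  neighbours-sym : ∀ {v w} → w ∈ neighbours v → v ∈ neighbours w
  neighbours-sym {v} {w} w∈N =
    lookup⇒[]= v (neighbours w)
      (trans (lookup∘tabulate (Adj G w) v) (trans (Adj-sym G w v) (∈-neighbours⁻ w∈N)))

  neighbours∩p⊆p-v : ∀ {v} (p : Subset n) → neighbours v ∩ p ⊆ p - v
  neighbours∩p⊆p-v {v} p w∈N∩p with x∈p∩q⁻ (neighbours v) p w∈N∩p
  ... | w∈N , w∈p =
    x∈p∧x≢y⇒x∈p-y w∈p λ { refl → contradiction (trans (sym (∈-neighbours⁻ w∈N)) (irrefl G v)) λ () }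

  MaxDegHalfOn : Subset n → Set
  MaxDegHalfOn r = ∀ {v} → v ∈ r → 2 * ∣ neighbours v ∩ r ∣ ≤ ∣ r ∣

  record Linkage (U A B : Subset n) : Set where
    field
      start    : Fin n
      rest     : List (Fin n)
      end      : Fin n
      isPath   : IsPath G (start ∷ rest)
      last≡end : last (start ∷ rest) ≡ just end
      start∈A  : start ∈ A
      end∈B    : end ∈ B
      ⊆U       : All (_∈ U) (start ∷ rest)
      balanced : MaxDegHalfOn (U ─ vertices (start ∷ rest))

  Linkage-mono : ∀ {U A A′ B B′} → A ⊆ A′ → B ⊆ B′ → Linkage U A B → Linkage U A′ B′
  Linkage-mono A⊆A′ B⊆B′ L = record { Linkage L hiding (start∈A; end∈B)
                                    ; start∈A = A⊆A′ (Linkage.start∈A L) ; end∈B = B⊆B′ (Linkage.end∈B L) }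

  prepend : ∀ {U A B v} → v ∈ U → v ∈ A → Linkage (U - v) (neighbours v) B → Linkage U A B
  prepend {U} {v = v} v∈U v∈A L = record
    { start    = v
    ; rest     = start ∷ rest
    ; end      = end
    ; isPath   = (All.map (≢-sym ∘ x∈p-y⇒x≢y) ⊆U ∷ proj₁ isPath) , adjacent start∈A ∷ proj₂ isPath
    ; last≡end = last≡end
    ; start∈A  = v∈A
    ; end∈B    = end∈B
    ; ⊆U       = v∈U ∷ All.map (p─q⊆p U ⁅ v ⁆) ⊆U
    ; balanced = subst MaxDegHalfOn (p─q─r≡p─q∪r U ⁅ v ⁆ (vertices (start ∷ rest))) balanced
    }
    where open Linkage L

  append : ∀ {U A B v} → v ∈ U → v ∈ B → Linkage (U - v) A (neighbours v) → Linkage U A B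
  append {U} {v = v} v∈U v∈B L = record
    { start    = start
    ; rest     = rest ∷ʳ v
    ; end      = v
    ; isPath   = AllPairs.++⁺ (proj₁ isPath) ([] ∷ []) (All.map (λ w∈U-v → x∈p-y⇒x≢y w∈U-v ∷ []) ⊆U)
               , Linked.++⁺ (proj₂ isPath) (subst (λ e → Connected _ e (just v)) (sym last≡end) (just end-adj-v)) [-]
    ; last≡end = last-∷ʳ (start ∷ rest) v
    ; start∈A  = start∈A
    ; end∈B    = v∈B
    ; ⊆U       = All.++⁺ (All.map (p─q⊆p U ⁅ v ⁆) ⊆U) (v∈U ∷ [])
    ; balanced = subst MaxDegHalfOn remaining≡ balanced
    }
    where
      open Linkage L
      end-adj-v : T (Adj G end v)
      end-adj-v = adjacent (neighbours-sym end∈B)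
      remaining≡ : U - v ─ vertices (start ∷ rest) ≡ U ─ vertices (start ∷ rest ∷ʳ v)
      remaining≡ = begin
        U - v ─ vertices (start ∷ rest)          ≡⟨ p─q─r≡p─q∪r U ⁅ v ⁆ (vertices (start ∷ rest)) ⟩
        U ─ (⁅ v ⁆ ∪ vertices (start ∷ rest))    ≡⟨ cong (U ─_) (∪-comm ⁅ v ⁆ (vertices (start ∷ rest))) ⟩
        U ─ (vertices (start ∷ rest) ∪ ⁅ v ⁆)    ≡⟨ cong (U ─_) (vertices-∷ʳ (start ∷ rest) v) ⟨
        U ─ vertices (start ∷ rest ∷ʳ v)         ∎
        where open ≡-Reasoning

  Linkable : Subset n → Set
  Linkable U = ∀ {A B} → A ⊆ U → B ⊆ U → ∣ U ∣ ≤ 2 * ∣ A ∣ → ∣ U ∣ < 2 * ∣ B ∣ → Linkage U A B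

  linkable-sparse : ∀ {U} → (∀ {v} → v ∈ U → 2 * ∣ neighbours v ∩ U ∣ < ∣ U ∣) → Linkable U
  linkable-sparse {U} sparse {A} {B} A⊆U B⊆U ∣U∣≤2∣A∣ ∣U∣<2∣B∣
    with ∣r∣<∣p∣+∣q∣⇒p∩q≢∅ A⊆U B⊆U (m≤2a∧m<2b⇒m<a+b ∣ A ∣ ∣ B ∣ ∣U∣≤2∣A∣ ∣U∣<2∣B∣)
  ... | x , x∈A∩B = record
    { start    = x
    ; rest     = []
    ; end      = x
    ; isPath   = [] ∷ [] , [-]
    ; last≡end = refl
    ; start∈A  = proj₁ (x∈p∩q⁻ A B x∈A∩B)
    ; end∈B    = proj₂ (x∈p∩q⁻ A B x∈A∩B)
    ; ⊆U       = x∈U ∷ []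
    ; balanced = subst MaxDegHalfOn (cong (U ─_) (sym (∪-identityʳ ⁅ x ⁆))) balanced
    }
    where
      x∈U : x ∈ U
      x∈U = A⊆U (proj₁ (x∈p∩q⁻ A B x∈A∩B))
      balanced : MaxDegHalfOn (U - x)
      balanced {v} v∈U-x = ≤-pred (begin-strict
        2 * ∣ neighbours v ∩ (U - x) ∣ ≤⟨ *-monoʳ-≤ 2 (p⊆q⇒∣p∣≤∣q∣ N∩[U-x]⊆N∩U) ⟩
        2 * ∣ neighbours v ∩ U ∣       <⟨ sparse (p─q⊆p U ⁅ x ⁆ v∈U-x) ⟩
        ∣ U ∣                          ≡⟨ x∈p⇒∣p∣≡1+∣p-x∣ x∈U ⟩
        suc ∣ U - x ∣                  ∎)
        where
          open ≤-Reasoning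
          N∩[U-x]⊆N∩U : neighbours v ∩ (U - x) ⊆ neighbours v ∩ U
          N∩[U-x]⊆N∩U = ∩-monoʳ-⊆ (p─q⊆p U ⁅ x ⁆)

  LinkableBelow : Subset n → Set
  LinkableBelow U = ∀ {U′} → U′ ⊂ U → Linkable U′

  module _ {U v} (ih : LinkableBelow U) (v∈U : v ∈ U) (dense : ∣ U ∣ ≤ 2 * ∣ neighbours v ∩ U ∣) where

    start-at : ∀ {A B B′} → v ∈ A → B′ ⊆ B → B′ ⊆ U - v → ∣ U - v ∣ < 2 * ∣ B′ ∣ → Linkage U A B
    start-at v∈A B′⊆B B′⊆U-v ∣U-v∣<2∣B′∣ =
      prepend v∈U v∈A (Linkage-mono (p∩q⊆p (neighbours v) U) B′⊆B
        (ih (x∈p⇒p-x⊂p v∈U) (neighbours∩p⊆p-v U) B′⊆U-v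
            (≤-trans (<⇒≤ (x∈p⇒∣p-x∣<∣p∣ v∈U)) dense) ∣U-v∣<2∣B′∣))

    end-at : ∀ {A A′ B} → v ∈ B → A′ ⊆ A → A′ ⊆ U - v → ∣ U - v ∣ ≤ 2 * ∣ A′ ∣ → Linkage U A B
    end-at v∈B A′⊆A A′⊆U-v ∣U-v∣≤2∣A′∣ =
      append v∈U v∈B (Linkage-mono A′⊆A (p∩q⊆p (neighbours v) U)
        (ih (x∈p⇒p-x⊂p v∈U) A′⊆U-v (neighbours∩p⊆p-v U)
            ∣U-v∣≤2∣A′∣ (<-≤-trans (x∈p⇒∣p-x∣<∣p∣ v∈U) dense)))

    detour : ∀ {A B} → v ∉ A → v ∉ B → A ⊆ U → B ⊆ U → ∣ U ∣ ≤ 2 * ∣ A ∣ → ∣ U ∣ < 2 * ∣ B ∣ → Linkage U A B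
    detour {A} {B} v∉A v∉B A⊆U B⊆U ∣U∣≤2∣A∣ ∣U∣<2∣B∣
      with ∣r∣<∣p∣+∣q∣⇒p∩q≢∅ (x∉p∧p⊆q⇒p⊆q-x v∉A A⊆U) (neighbours∩p⊆p-v U)
             (<-≤-trans (x∈p⇒∣p-x∣<∣p∣ v∈U) (m≤2a∧m≤2b⇒m≤a+b ∣ A ∣ ∣ neighbours v ∩ U ∣ ∣U∣≤2∣A∣ dense))
    ... | x , x∈A∩N =
      prepend x∈U x∈A (Linkage-mono ⁅v⁆⊆Nx (p─q⊆p B ⁅ x ⁆)
        (prepend (x∈p∧x≢y⇒x∈p-y v∈U (x∈p-y⇒x≢y x∈U-v ∘ sym)) (x∈⁅x⁆ v)
          (Linkage-mono (p∩q⊆p (neighbours v) U ∘ p─q⊆p _ ⁅ x ⁆) ⊆-refl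
            (subst (λ W → Linkage W (neighbours v ∩ U - x) (B - x)) (p─x─y≡p─y─x U v x) L))))
      where
        x∈A : x ∈ A
        x∈A = proj₁ (x∈p∩q⁻ A _ x∈A∩N)
        x∈N∩U : x ∈ neighbours v ∩ U
        x∈N∩U = proj₂ (x∈p∩q⁻ A _ x∈A∩N)
        x∈U-v : x ∈ U - v
        x∈U-v = neighbours∩p⊆p-v U x∈N∩U
        x∈U : x ∈ U
        x∈U = p─q⊆p U ⁅ v ⁆ x∈U-v
        ⁅v⁆⊆Nx : ⁅ v ⁆ ⊆ neighbours x
        ⁅v⁆⊆Nx w∈⁅v⁆ = subst (_∈ neighbours x) (sym (x∈⁅y⁆⇒x≡y v w∈⁅v⁆))
                         (neighbours-sym (proj₁ (x∈p∩q⁻ (neighbours v) U x∈N∩U)))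
        ∣U∣≡2+∣U-v-x∣ : ∣ U ∣ ≡ 2 + ∣ U - v - x ∣
        ∣U∣≡2+∣U-v-x∣ = trans (x∈p⇒∣p∣≡1+∣p-x∣ v∈U) (cong suc (x∈p⇒∣p∣≡1+∣p-x∣ x∈U-v))
        L : Linkage (U - v - x) (neighbours v ∩ U - x) (B - x)
        L = ih (⊆-⊂-trans (p─q⊆p (U - v) ⁅ x ⁆) (x∈p⇒p-x⊂p v∈U))
               (p⊆q⇒p-x⊆q-x (neighbours∩p⊆p-v U))
               (p⊆q⇒p-x⊆q-x (x∉p∧p⊆q⇒p⊆q-x v∉B B⊆U))
               (2+m≤2[1+a]⇒m≤2a ∣ neighbours v ∩ U - x ∣
                  (subst₂ (λ u d → u ≤ 2 * d) ∣U∣≡2+∣U-v-x∣ (x∈p⇒∣p∣≡1+∣p-x∣ x∈N∩U) dense))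
               (2+m<2b∧b≤1+c⇒m<2c ∣ B - x ∣
                  (subst (_< 2 * ∣ B ∣) ∣U∣≡2+∣U-v-x∣ ∣U∣<2∣B∣) (∣p∣≤1+∣p-x∣ B x))

    linkable-dense : Linkable U
    linkable-dense {A} {B} A⊆U B⊆U ∣U∣≤2∣A∣ ∣U∣<2∣B∣ with v ∈? A | v ∈? B
    ... | yes v∈A | no v∉B =
      start-at v∈A ⊆-refl (x∉p∧p⊆q⇒p⊆q-x v∉B B⊆U) (<-trans (x∈p⇒∣p-x∣<∣p∣ v∈U) ∣U∣<2∣B∣)
    ... | no v∉A | yes v∈B =
      end-at v∈B ⊆-refl (x∉p∧p⊆q⇒p⊆q-x v∉A A⊆U) (≤-trans (<⇒≤ (x∈p⇒∣p-x∣<∣p∣ v∈U)) ∣U∣≤2∣A∣)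
    ... | no v∉A | no v∉B = detour v∉A v∉B A⊆U B⊆U ∣U∣≤2∣A∣ ∣U∣<2∣B∣
    -- If v cannot start the path then |U| = 2|B| - 1 is odd, so |U| < 2|A| and v can end it.
    ... | yes v∈A | yes v∈B with ∣ U - v ∣ <? 2 * ∣ B - v ∣
    ...   | yes fits = start-at v∈A (p─q⊆p B ⁅ v ⁆) (p⊆q⇒p-x⊆q-x B⊆U) fits
    ...   | no ¬fits = end-at v∈B (p─q⊆p A ⁅ v ⁆) (p⊆q⇒p-x⊆q-x A⊆U)
      (m≮2b∧1+m<2[1+b]∧1+m≤2[1+a]⇒m≤2a ∣ A - v ∣ ∣ B - v ∣ ¬fits
        (subst₂ (λ u b → u < 2 * b) (x∈p⇒∣p∣≡1+∣p-x∣ v∈U) (x∈p⇒∣p∣≡1+∣p-x∣ v∈B) ∣U∣<2∣B∣)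
        (subst₂ (λ u a → u ≤ 2 * a) (x∈p⇒∣p∣≡1+∣p-x∣ v∈U) (x∈p⇒∣p∣≡1+∣p-x∣ v∈A) ∣U∣≤2∣A∣))

  linkable : ∀ U → Acc _⊂_ U → Linkable U
  linkable U (acc rec) with any? (λ v → v ∈? U ×-dec ∣ U ∣ ≤? 2 * ∣ neighbours v ∩ U ∣)
  ... | yes (v , v∈U , dense) = linkable-dense (λ U′⊂U → linkable _ (rec U′⊂U)) v∈U dense
  ... | no ¬dense = linkable-sparse (λ v∈U → ≰⇒> (λ dense → ¬dense (_ , v∈U , dense)))

  MaxDegHalfOn⇒MaxDegHalf : ∀ (P : List (Fin n)) → MaxDegHalfOn (⊤ ─ vertices P) → MaxDegHalf G P
  MaxDegHalfOn⇒MaxDegHalf P balanced v v∉P =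
    subst₂ _≤_ (cong (2 *_) (sym degMinus≡)) (sym sizeMinus≡) (balanced v∈R)
    where
      sizeMinus≡ : sizeMinus P ≡ ∣ ⊤ ─ vertices P ∣
      sizeMinus≡ = trans (count≡∣tabulate∣ (λ w → not (onPath P w))) (cong ∣_∣ (tabulate-¬onPath P))
      degMinus≡ : degMinus G P v ≡ ∣ neighbours v ∩ (⊤ ─ vertices P) ∣
      degMinus≡ = trans (count≡∣tabulate∣ (λ w → Adj G v w ∧ not (onPath P w)))
        (cong ∣_∣ (trans (tabulate-∧ (Adj G v) (λ w → not (onPath P w)))
                         (cong (neighbours v ∩_) (tabulate-¬onPath P))))
      v∈R : v ∈ ⊤ ─ vertices P
      v∈R = lookup⇒[]= v (⊤ ─ vertices P)
        (trans (lookup-⊤─ (vertices P) v) (cong not (trans (lookup-vertices P v) v∉P)))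

lemma2p2 : (n : ℕ) (G : Graph n) (A B : Subset n) →
    n ≤ 2 * ∣ A ∣ → n < 2 * ∣ B ∣ →
    Σ (List (Fin n)) λ P → Σ (Fin n) λ a → Σ (Fin n) λ b →
      IsPath G P × head P ≡ just a × last P ≡ just b × a ∈ A × b ∈ B ×
      MaxDegHalf G P
lemma2p2 n G A B n≤2∣A∣ n<2∣B∣ =
  start ∷ rest , start , end , isPath , refl , last≡end , start∈A , end∈B ,
  MaxDegHalfOn⇒MaxDegHalf G (start ∷ rest) balanced
  where
    open Linkage (linkable G ⊤ (⊂-wellFounded ⊤) {A} {B} ⊆⊤ ⊆⊤
                   (subst (_≤ 2 * ∣ A ∣) (sym (∣⊤∣≡n n)) n≤2∣A∣)
                   (subst (_< 2 * ∣ B ∣) (sym (∣⊤∣≡n n)) n<2∣B∣))
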